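{- Let $r\ge4$ and $n\ge r+2$ be integers, let $X=\{2,4,r+2\}$ and $\mathcal{A}=F(r,n,\{\{2,3\}\})$. If $n<\frac{3r+1+\sqrt{5r^2-22r+25}}{2}$, then $|\mathcal{A}(X)|>|\mathcal{S}_{n,r}(X)|$.
   Context: $[n]=\{1,\dots,n\}$; $\binom{[n]}{r}$ is the set of $r$-subsets of $[n]$, listed increasingly. For $A=\{a_1<\dots<a_r\}$ and $C=\{c_1<\dots<c_k\}$, write $A\prec C$ if $r\ge k$ and $a_i\le c_i$ for $1\le i\le k$. For $\mathcal{G}\subseteq2^{[n]}$, $F(r,n,\mathcal{G})=\{A\in\binom{[n]}{r}:A\prec G\text{ for some }G\in\mathcal{G}\}$. For a family $\mathcal{A}$ and set $X$, $\mathcal{A}(X)=\{A\in\mathcal{A}:A\cap X\ne\emptyset\}$; $\mathcal{S}_{n,r}=\{A\in\binom{[n]}{r}:1\in A\}$. -}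

module Defs where

open import Data.Bool using (Bool; true; false)
open import Data.Nat using (ℕ; zero; suc; _≤_; _≟_; _≤?_)
open import Data.List using (List; []; _∷_; map; filter; _++_; length)
open import Data.List.Relation.Unary.Any using (Any; any?)
open import Data.List.Membership.DecPropositional _≟_ using (_∈_; _∈?_)
open import Data.Vec using (Vec; []; _∷_)
open import Data.Product using (_×_; _,_)
open import Data.Unit using (⊤; tt)
open import Data.Empty using (⊥)
open import Relation.Nullary using (Dec; yes; no)
open import Relation.Nullary.Decidable using (_×-dec_)

-- A subset of [n] = {1,…,n} is a characteristic vector: position i (0-based)
-- records whether i+1 belongs to the set.
SubsetOf : ℕ → Set
SubsetOf n = Vec Bool n

elems : ∀ {n} → SubsetOf n → List ℕ
elems []           = []
elems (true  ∷ p)  = 1 ∷ map suc (elems p)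
elems (false ∷ p)  = map suc (elems p)

card : ∀ {n} → SubsetOf n → ℕ
card p = length (elems p)

allSubsets : ∀ n → List (SubsetOf n)
allSubsets zero    = [] ∷ []
allSubsets (suc n) = map (true ∷_) (allSubsets n) ++ map (false ∷_) (allSubsets n)

_≺_ : List ℕ → List ℕ → Set
_        ≺ []       = ⊤
[]       ≺ (c ∷ cs) = ⊥
(a ∷ as) ≺ (c ∷ cs) = (a ≤ c) × (as ≺ cs)

_≺?_ : (A C : List ℕ) → Dec (A ≺ C)
A        ≺? []       = yes tt
[]       ≺? (c ∷ cs) = no (λ ())
(a ∷ as) ≺? (c ∷ cs) = (a ≤? c) ×-dec (as ≺? cs)

binom : ∀ n → ℕ → List (SubsetOf n)
binom n r = filter (λ A → card A ≟ r) (allSubsets n)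

-- F(r,n,𝒢) = {A ∈ binom([n],r) : A ≺ G for some G ∈ 𝒢};
-- the members of 𝒢 are given as increasingly listed subsets of [n].
F : ∀ r n → List (List ℕ) → List (SubsetOf n)
F r n 𝒢 = filter (λ A → any? (λ G → elems A ≺? G) 𝒢) (binom n r)

restrict : ∀ {n} → List (SubsetOf n) → List ℕ → List (SubsetOf n)
restrict 𝒜 X = filter (λ A → any? (λ x → x ∈? elems A) X) 𝒜

S : ∀ n r → List (SubsetOf n)
S n r = filter (λ A → 1 ∈? elems A) (binom n r)

-- Encode the subsets of [n] by characteristic vectors and count them along their first four bits.
-- 𝒮(X) and 𝒜(X) share everything except the sets that contain 1 but not 2, 3 (and meet {4, r + 2})
-- and those that contain 2, 3 but not 1; counting both classes and applying Pascal's rule gives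
--   |𝒮(X)| + C(n-4, r-3) = |𝒜(X)| + C(n-5, r-2).
-- With e = n - r - 2, the absorption identity (k+1) C(N, k+1) + k C(N, k) = N C(N, k) reduces
-- C(n-5, r-2) < C(n-4, r-3) to e(e+1) < (r-2)(n-4), and 4e(e+1) - 4(r-2)(n-4) is exactly
-- (2n - 3r - 1)² - (5r² - 22r + 25).
module Submission where

open import Defs
open import Level using (Level)
open import Data.Bool using (Bool; true; false; _∧_; _∨_; if_then_else_)
open import Data.Bool.Properties using (∧-comm; ∨-identityʳ)
open import Data.Nat using (ℕ; zero; suc; _+_; _*_; _∸_; _≤_; _<_; _≡ᵇ_; z≤n; s≤s; _≟_; _≤?_; >-nonZero; s≤s⁻¹)
open import Data.Nat.Properties
open import Data.Nat.Combinatorics using (_C_; nC1≡n; nCk+nC[k+1]≡[n+1]C[k+1])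
open import Data.Nat.Tactic.RingSolver using (solve; solve-∀)
open import Data.List using (List; []; _∷_; length; map; filter; _++_)
import Data.List as List
open import Data.List.Properties using (filter-++; length-++; length-map)
open import Data.List.Relation.Unary.Any using (any?)
open import Data.List.Membership.DecPropositional _≟_ using (_∈?_)
open import Data.Vec using (Vec; []; _∷_)
open import Data.Product using (_,_)
open import Relation.Nullary using (does; yes; no)
open import Relation.Nullary.Decidable using (dec-false)
open import Relation.Unary using (Pred; Decidable)
open import Relation.Unary.Properties using (_∩?_)
open import Relation.Binary.PropositionalEquality

private
  variable
    ℓ ℓ₁ ℓ₂ : Level
    A B : Set ℓ

filter-filter : {P : Pred A ℓ₁} {Q : Pred A ℓ₂} (P? : Decidable P) (Q? : Decidable Q) (xs : List A) →
  filter Q? (filter P? xs) ≡ filter (P? ∩? Q?) xs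
filter-filter P? Q? []       = refl
filter-filter P? Q? (x ∷ xs) with does (P? x)
... | false = filter-filter P? Q? xs
... | true with does (Q? x)
...   | false = filter-filter P? Q? xs
...   | true  = cong (x ∷_) (filter-filter P? Q? xs)

filter-map : {P : Pred B ℓ₁} (P? : Decidable P) (f : A → B) (xs : List A) →
  filter P? (map f xs) ≡ map f (filter (λ x → P? (f x)) xs)
filter-map P? f []       = refl
filter-map P? f (x ∷ xs) with does (P? (f x))
... | false = filter-map P? f xs
... | true  = cong (f x ∷_) (filter-map P? f xs)

count : ∀ n → (Vec Bool n → Bool) → ℕ
count zero    f = if f [] then 1 else 0
count (suc n) f = count n (λ p → f (true ∷ p)) + count n (λ p → f (false ∷ p))

count-cong : ∀ n {f g : Vec Bool n → Bool} → (∀ p → f p ≡ g p) → count n f ≡ count n g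
count-cong zero    f≗g = cong (λ b → if b then 1 else 0) (f≗g [])
count-cong (suc n) f≗g = cong₂ _+_ (count-cong n (λ p → f≗g (true ∷ p))) (count-cong n (λ p → f≗g (false ∷ p)))

count-false : ∀ n → count n (λ _ → false) ≡ 0
count-false zero    = refl
count-false (suc n) = cong₂ _+_ (count-false n) (count-false n)

length-filter-allSubsets : ∀ n {P : Pred (Vec Bool n) ℓ₁} (P? : Decidable P) →
  length (filter P? (allSubsets n)) ≡ count n (λ p → does (P? p))
length-filter-allSubsets zero P? with does (P? [])
... | false = refl
... | true  = refl
length-filter-allSubsets (suc n) P? = begin
  length (filter P? (map (true ∷_) Aₙ ++ map (false ∷_) Aₙ))
    ≡⟨ cong length (filter-++ P? (map (true ∷_) Aₙ) (map (false ∷_) Aₙ)) ⟩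
  length (filter P? (map (true ∷_) Aₙ) ++ filter P? (map (false ∷_) Aₙ))
    ≡⟨ length-++ (filter P? (map (true ∷_) Aₙ)) ⟩
  length (filter P? (map (true ∷_) Aₙ)) + length (filter P? (map (false ∷_) Aₙ))
    ≡⟨ cong₂ _+_ (extend true) (extend false) ⟩
  count (suc n) (λ p → does (P? p)) ∎
  where
  open ≡-Reasoning
  Aₙ = allSubsets n
  extend : ∀ b → length (filter P? (map (b ∷_) Aₙ)) ≡ count n (λ p → does (P? (b ∷ p)))
  extend b = begin
    length (filter P? (map (b ∷_) Aₙ))                     ≡⟨ cong length (filter-map P? (b ∷_) Aₙ) ⟩
    length (map (b ∷_) (filter (λ p → P? (b ∷ p)) Aₙ))     ≡⟨ length-map (b ∷_) (filter (λ p → P? (b ∷ p)) Aₙ) ⟩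
    length (filter (λ p → P? (b ∷ p)) Aₙ)                  ≡⟨ length-filter-allSubsets n (λ p → P? (b ∷ p)) ⟩
    count n (λ p → does (P? (b ∷ p)))                       ∎

length-filter²-binom : ∀ n r {P : Pred (SubsetOf n) ℓ₁} {Q : Pred (SubsetOf n) ℓ₂} (P? : Decidable P) (Q? : Decidable Q) →
  length (filter Q? (filter P? (binom n r))) ≡ count n (λ p → does (card p ≟ r) ∧ (does (P? p) ∧ does (Q? p)))
length-filter²-binom n r P? Q? = begin
  length (filter Q? (filter P? (filter card≟r (allSubsets n))))
    ≡⟨ cong length (filter-filter P? Q? (binom n r)) ⟩
  length (filter (P? ∩? Q?) (filter card≟r (allSubsets n)))
    ≡⟨ cong length (filter-filter card≟r (P? ∩? Q?) (allSubsets n)) ⟩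
  length (filter (card≟r ∩? (P? ∩? Q?)) (allSubsets n))
    ≡⟨ length-filter-allSubsets n _ ⟩
  count n (λ p → does (card p ≟ r) ∧ (does (P? p) ∧ does (Q? p))) ∎
  where
  open ≡-Reasoning
  card≟r = λ (p : SubsetOf n) → card p ≟ r

ones : ∀ {n} → Vec Bool n → ℕ
ones []          = 0
ones (true ∷ p)  = suc (ones p)
ones (false ∷ p) = ones p

-- bit i p says whether i + 1 ∈ p (false out of range).
bit : ∀ {n} → ℕ → Vec Bool n → Bool
bit i       []      = false
bit zero    (b ∷ p) = b
bit (suc i) (b ∷ p) = bit i p

card≡ones : ∀ {n} (p : SubsetOf n) → card p ≡ ones p
card≡ones []          = refl
card≡ones (true ∷ p)  = cong suc (trans (length-map suc (elems p)) (card≡ones p))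
card≡ones (false ∷ p) = trans (length-map suc (elems p)) (card≡ones p)

suc-∈?-map-suc : ∀ x xs → does (suc x ∈? map suc xs) ≡ does (x ∈? xs)
suc-∈?-map-suc x []       = refl
suc-∈?-map-suc x (y ∷ ys) = cong (does (x ≟ y) ∨_) (suc-∈?-map-suc x ys)

zero-∈?-map-suc : ∀ xs → does (0 ∈? map suc xs) ≡ false
zero-∈?-map-suc []       = refl
zero-∈?-map-suc (x ∷ xs) = zero-∈?-map-suc xs

zero-∈?-elems : ∀ {n} (p : SubsetOf n) → does (0 ∈? elems p) ≡ false
zero-∈?-elems []          = refl
zero-∈?-elems (true ∷ p)  = zero-∈?-map-suc (elems p)
zero-∈?-elems (false ∷ p) = zero-∈?-map-suc (elems p)

∈?-elems : ∀ {n} i (p : SubsetOf n) → does (suc i ∈? elems p) ≡ bit i p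
∈?-elems i       []          = refl
∈?-elems zero    (true ∷ p)  = refl
∈?-elems zero    (false ∷ p) = trans (suc-∈?-map-suc 0 (elems p)) (zero-∈?-elems p)
∈?-elems (suc i) (true ∷ p)  = trans (suc-∈?-map-suc (suc i) (elems p)) (∈?-elems i p)
∈?-elems (suc i) (false ∷ p) = trans (suc-∈?-map-suc (suc i) (elems p)) (∈?-elems i p)

count-ones : ∀ m s → count m (λ q → ones q ≡ᵇ s) ≡ m C s
count-ones zero    zero    = refl
count-ones zero    (suc s) = refl
count-ones (suc m) zero    = cong₂ _+_ (count-false m) (count-ones m 0)
count-ones (suc m) (suc s) = trans (cong₂ _+_ (count-ones m s) (count-ones m (suc s))) (nCk+nC[k+1]≡[n+1]C[k+1] m s)

count-bit : ∀ {m i} (g : ℕ → Bool) → i ≤ m →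
  count (suc m) (λ q → bit i q ∧ g (ones q)) ≡ count m (λ q → g (suc (ones q)))
count-bit {m} {zero}  g z≤n       =
  trans (cong (count m (λ q → g (suc (ones q))) +_) (count-false m)) (+-identityʳ _)
count-bit {suc m} {suc i} g (s≤s i≤m) = cong₂ _+_ (count-bit (λ s → g (suc s)) i≤m) (count-bit g i≤m)

-- The elements of A after its first three bits are at least 4.
≺?-tail≡false : ∀ {n c} (q : SubsetOf n) cs → c ≤ 3 →
  does (map suc (map suc (map suc (elems q))) ≺? (c ∷ cs)) ≡ false
≺?-tail≡false []          cs c≤3 = refl
≺?-tail≡false {c = c} (true ∷ q) cs c≤3
  rewrite dec-false (4 ≤? c) (≤⇒≯ c≤3) = refl
≺?-tail≡false {c = c} (false ∷ q) cs c≤3 with elems q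
... | []    = refl
... | x ∷ _ rewrite dec-false (suc (suc (suc (suc x))) ≤? c) (λ 4+x≤c → ≤⇒≯ c≤3 (≤-trans (m≤m+n 4 x) 4+x≤c)) = refl

≺?[2,3]≡majority : ∀ {n} b₁ b₂ b₃ (q : SubsetOf n) →
  does (elems (b₁ ∷ b₂ ∷ b₃ ∷ q) ≺? (2 ∷ 3 ∷ [])) ≡ (b₁ ∧ (b₂ ∨ b₃)) ∨ (b₂ ∧ b₃)
≺?[2,3]≡majority true  true  _     q = refl
≺?[2,3]≡majority true  false true  q = refl
≺?[2,3]≡majority true  false false q = ≺?-tail≡false q [] ≤-refl
≺?[2,3]≡majority false true  true  q = refl
≺?[2,3]≡majority false true  false q = ≺?-tail≡false q [] ≤-refl
≺?[2,3]≡majority false false true  q = refl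
≺?[2,3]≡majority false false false q = ≺?-tail≡false q (3 ∷ []) (n≤1+n 2)

module _ (t M : ℕ) where

  private
    r n : ℕ
    r = 4 + t
    n = 5 + M

    X : List ℕ
    X = 2 ∷ 4 ∷ (r + 2) ∷ []

    -- The predicates defining 𝒮(X) and 𝒜(X), with the cardinality test moved last so that
    -- count n unfolds along the leading bits; bit (suc t) q is the bit of r + 2.
    inS inA : SubsetOf n → Bool
    inS p@(b₁ ∷ b₂ ∷ _  ∷ b₄ ∷ q) = (b₁ ∧ (b₂ ∨ (b₄ ∨ bit (suc t) q))) ∧ (ones p ≡ᵇ r)
    inA p@(b₁ ∷ b₂ ∷ b₃ ∷ b₄ ∷ q) = (((b₁ ∧ (b₂ ∨ b₃)) ∨ (b₂ ∧ b₃)) ∧ (b₂ ∨ (b₄ ∨ bit (suc t) q))) ∧ (ones p ≡ᵇ r)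

    meets-X : ∀ b₁ b₂ b₃ b₄ (q : SubsetOf (suc M)) →
      does (any? (_∈? elems (b₁ ∷ b₂ ∷ b₃ ∷ b₄ ∷ q)) X) ≡ b₂ ∨ (b₄ ∨ bit (suc t) q)
    meets-X b₁ b₂ b₃ b₄ q = cong₂ _∨_ (∈?-elems 1 p) (cong₂ _∨_ (∈?-elems 3 p) (trans (∨-identityʳ _) r+2∈?p))
      where
      p = b₁ ∷ b₂ ∷ b₃ ∷ b₄ ∷ q
      r+2∈?p : does ((r + 2) ∈? elems p) ≡ bit (suc t) q
      r+2∈?p = trans (∈?-elems (3 + (t + 2)) p) (cong (λ i → bit i (b₄ ∷ q)) (+-comm t 2))

    length-S[X] : length (restrict (S n r) X) ≡ count n inS
    length-S[X] = trans (length-filter²-binom n r _ _) (count-cong n pointwise)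
      where
      pointwise : ∀ p → does (card p ≟ r) ∧ (does (1 ∈? elems p) ∧ does (any? (_∈? elems p) X)) ≡ inS p
      pointwise p@(b₁ ∷ b₂ ∷ b₃ ∷ b₄ ∷ q) = trans
        (cong₂ _∧_ (cong (_≡ᵇ r) (card≡ones p)) (cong₂ _∧_ (∈?-elems 0 p) (meets-X b₁ b₂ b₃ b₄ q)))
        (∧-comm (ones p ≡ᵇ r) _)

    length-F[X] : length (restrict (F r n ((2 ∷ 3 ∷ []) ∷ [])) X) ≡ count n inA
    length-F[X] = trans (length-filter²-binom n r _ _) (count-cong n pointwise)
      where
      pointwise : ∀ p → does (card p ≟ r) ∧ ((does (elems p ≺? (2 ∷ 3 ∷ [])) ∨ false) ∧ does (any? (_∈? elems p) X)) ≡ inA p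
      pointwise p@(b₁ ∷ b₂ ∷ b₃ ∷ b₄ ∷ q) = trans
        (cong₂ _∧_ (cong (_≡ᵇ r) (card≡ones p))
          (cong₂ _∧_ (trans (∨-identityʳ _) (≺?[2,3]≡majority b₁ b₂ b₃ (b₄ ∷ q))) (meets-X b₁ b₂ b₃ b₄ q)))
        (∧-comm (ones p ≡ᵇ r) _)

    a e : ℕ → ℕ
    a s = count (suc M) (λ q → ones q ≡ᵇ s)
    e s = count (suc M) (λ q → bit (suc t) q ∧ (ones q ≡ᵇ s))

    -- count n inS and count n inA unfold definitionally along the first four bits into sums of
    -- a s, e s and count (suc M) (λ _ → false).
    count-inS : count n inS ≡ a t + 3 * a (1 + t) + 2 * a (2 + t) + e (2 + t) + e (3 + t)
    count-inS = tally (a t) (a (1 + t)) (a (2 + t)) (e (2 + t)) (e (3 + t)) (count-false (suc M))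
      where
      tally : ∀ a₀ a₁ a₂ e₂ e₃ {z} → z ≡ 0 →
        (((a₀ + a₁) + (a₁ + a₂)) + ((a₁ + e₂) + (a₂ + e₃))) + (((z + z) + (z + z)) + ((z + z) + (z + z)))
          ≡ a₀ + 3 * a₁ + 2 * a₂ + e₂ + e₃
      tally a₀ a₁ a₂ e₂ e₃ refl = solve (a₀ List.∷ a₁ List.∷ a₂ List.∷ e₂ List.∷ e₃ List.∷ List.[])

    count-inA : count n inA ≡ a t + 4 * a (1 + t) + 2 * a (2 + t) + e (2 + t)
    count-inA = tally (a t) (a (1 + t)) (a (2 + t)) (e (2 + t)) (count-false (suc M))
      where
      tally : ∀ a₀ a₁ a₂ e₂ {z} → z ≡ 0 →
        (((a₀ + a₁) + (a₁ + a₂)) + ((a₁ + e₂) + (z + z))) + (((a₁ + a₂) + (z + z)) + ((z + z) + (z + z)))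
          ≡ a₀ + 4 * a₁ + 2 * a₂ + e₂
      tally a₀ a₁ a₂ e₂ refl = solve (a₀ List.∷ a₁ List.∷ a₂ List.∷ e₂ List.∷ List.[])

  length-S[X]+C≡length-F[X]+C : t < M →
    length (restrict (S n r) X) + suc M C suc t ≡ length (restrict (F r n ((2 ∷ 3 ∷ []) ∷ [])) X) + M C (2 + t)
  length-S[X]+C≡length-F[X]+C t<M = begin
    length (restrict (S n r) X) + suc M C suc t
      ≡⟨ cong₂ _+_ (trans length-S[X] count-inS) (sym (count-ones (suc M) (suc t))) ⟩
    (a₀ + 3 * a₁ + 2 * a₂ + e₂ + e₃) + a₁
      ≡⟨ exchange a₀ a₁ a₂ e₂ e₃ ⟩
    (a₀ + 4 * a₁ + 2 * a₂ + e₂) + e₃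
      ≡⟨ cong₂ _+_ (sym (trans length-F[X] count-inA)) (trans (count-bit (_≡ᵇ 3 + t) t<M) (count-ones M (2 + t))) ⟩
    length (restrict (F r n ((2 ∷ 3 ∷ []) ∷ [])) X) + M C (2 + t) ∎
    where
    open ≡-Reasoning
    a₀ = a t
    a₁ = a (1 + t)
    a₂ = a (2 + t)
    e₂ = e (2 + t)
    e₃ = e (3 + t)
    exchange : ∀ a₀ a₁ a₂ e₂ e₃ → (a₀ + 3 * a₁ + 2 * a₂ + e₂ + e₃) + a₁ ≡ (a₀ + 4 * a₁ + 2 * a₂ + e₂) + e₃
    exchange = solve-∀

k≤n⇒nCk>0 : ∀ {n k} → k ≤ n → 0 < n C k
k≤n⇒nCk>0 {k = zero} _ = s≤s z≤n
k≤n⇒nCk>0 {suc n} {suc k} (s≤s k≤n) =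
  subst (0 <_) (nCk+nC[k+1]≡[n+1]C[k+1] n k) (≤-trans (k≤n⇒nCk>0 k≤n) (m≤m+n (n C k) (n C suc k)))

[k+1]*nC[k+1]+k*nCk≡n*nCk : ∀ n k → suc k * (n C suc k) + k * (n C k) ≡ n * (n C k)
[k+1]*nC[k+1]+k*nCk≡n*nCk zero    zero    = refl
[k+1]*nC[k+1]+k*nCk≡n*nCk zero    (suc k) = cong₂ _+_ (*-zeroʳ (2 + k)) (*-zeroʳ (suc k))
[k+1]*nC[k+1]+k*nCk≡n*nCk (suc n) zero    =
  trans (+-identityʳ _) (trans (*-identityˡ _) (trans (nC1≡n (suc n)) (sym (*-identityʳ (suc n)))))
[k+1]*nC[k+1]+k*nCk≡n*nCk (suc n) (suc k) = begin
  (2 + k) * (suc n C (2 + k)) + (1 + k) * (suc n C suc k)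
    ≡⟨ cong₂ (λ u v → (2 + k) * u + (1 + k) * v) (sym (nCk+nC[k+1]≡[n+1]C[k+1] n (suc k))) (sym (nCk+nC[k+1]≡[n+1]C[k+1] n k)) ⟩
  (2 + k) * (n C suc k + n C (2 + k)) + (1 + k) * (n C k + n C suc k)
    ≡⟨ regroup k (n C k) (n C suc k) (n C (2 + k)) ⟩
  ((1 + k) * (n C suc k) + k * (n C k)) + n C k + (((2 + k) * (n C (2 + k)) + (1 + k) * (n C suc k)) + n C suc k)
    ≡⟨ cong₂ (λ u v → u + n C k + (v + n C suc k)) ([k+1]*nC[k+1]+k*nCk≡n*nCk n k) ([k+1]*nC[k+1]+k*nCk≡n*nCk n (suc k)) ⟩
  n * (n C k) + n C k + (n * (n C suc k) + n C suc k)
    ≡⟨ collect n (n C k) (n C suc k) ⟩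
  suc n * (n C k + n C suc k)
    ≡⟨ cong (suc n *_) (nCk+nC[k+1]≡[n+1]C[k+1] n k) ⟩
  suc n * (suc n C suc k) ∎
  where
  open ≡-Reasoning
  regroup : ∀ k x y w → (2 + k) * (y + w) + (1 + k) * (x + y) ≡ ((1 + k) * y + k * x) + x + (((2 + k) * w + (1 + k) * y) + y)
  regroup = solve-∀
  collect : ∀ n x y → n * x + x + (n * y + y) ≡ suc n * (x + y)
  collect = solve-∀

-- Writing N = suc t + e, absorption turns both sides into multiples of N C suc t.
[t+e+1]C[t+2]<[t+e+2]C[t+1] : ∀ t e → e * suc e < (2 + t) * suc (suc t + e) →
  (suc t + e) C (2 + t) < suc (suc t + e) C suc t
[t+e+1]C[t+2]<[t+e+2]C[t+1] t e hyp =
  subst (u <_) (nCk+nC[k+1]≡[n+1]C[k+1] N t) (*-cancelʳ-< ((2 + t) * suc e) u (c₀ + c) (begin-strict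
  u * ((2 + t) * suc e)                          ≡⟨ swap u (2 + t) (suc e) ⟩
  ((2 + t) * u) * suc e                          ≡⟨ cong (_* suc e) [2+t]u≡ec ⟩
  e * c * suc e                                  ≡⟨ swap′ e c (suc e) ⟩
  e * suc e * c                                  <⟨ *-monoˡ-< c {{>-nonZero c>0}} hyp ⟩
  (2 + t) * suc (suc t + e) * c                  ≡⟨ split t e c ⟩
  (2 + t) * ((1 + t) * c) + c * ((2 + t) * suc e) ≡⟨ cong (λ x → (2 + t) * x + c * ((2 + t) * suc e)) [1+t]c≡[1+e]c₀ ⟩
  (2 + t) * (suc e * c₀) + c * ((2 + t) * suc e) ≡⟨ merge t e c₀ c ⟩
  (c₀ + c) * ((2 + t) * suc e)                   ∎))
  where
  open ≤-Reasoning
  N c₀ c u : ℕ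
  N  = suc t + e
  c₀ = N C t
  c  = N C suc t
  u  = N C (2 + t)

  c>0 : 0 < c
  c>0 = k≤n⇒nCk>0 (s≤s (m≤m+n t e))

  [2+t]u≡ec : (2 + t) * u ≡ e * c
  [2+t]u≡ec = +-cancelʳ-≡ ((1 + t) * c) ((2 + t) * u) (e * c)
    (trans ([k+1]*nC[k+1]+k*nCk≡n*nCk N (suc t)) (trans (*-distribʳ-+ c (suc t) e) (+-comm ((1 + t) * c) (e * c))))

  [1+t]c≡[1+e]c₀ : (1 + t) * c ≡ suc e * c₀
  [1+t]c≡[1+e]c₀ = +-cancelʳ-≡ (t * c₀) ((1 + t) * c) (suc e * c₀)
    (trans ([k+1]*nC[k+1]+k*nCk≡n*nCk N t)
      (trans (cong (_* c₀) (sym (+-suc t e))) (trans (*-distribʳ-+ c₀ t (suc e)) (+-comm (t * c₀) (suc e * c₀)))))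

  swap : ∀ u a s → u * (a * s) ≡ (a * u) * s
  swap = solve-∀
  swap′ : ∀ e c s → e * c * s ≡ e * s * c
  swap′ = solve-∀
  split : ∀ t e c → (2 + t) * suc (suc t + e) * c ≡ (2 + t) * ((1 + t) * c) + c * ((2 + t) * suc e)
  split = solve-∀
  merge : ∀ t e c₀ c → (2 + t) * (suc e * c₀) + c * ((2 + t) * suc e) ≡ (c₀ + c) * ((2 + t) * suc e)
  merge = solve-∀

discriminant⇒D²-bound : ∀ t w → w * w + 22 * (4 + t) < 5 * (4 + t) * (4 + t) + 25 →
  (w + (3 + t)) * (w + (3 + t)) < 4 * (1 + t) * (2 + t) + 2 * (3 + t) * (w + (3 + t))
discriminant⇒D²-bound t w H = +-cancelʳ-< (22 * (4 + t)) _ _ (begin-strict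
  (w + (3 + t)) * (w + (3 + t)) + 22 * (4 + t)                   ≡⟨ expand t w ⟩
  (w * w + 22 * (4 + t)) + K                                     <⟨ +-monoˡ-< K H ⟩
  (5 * (4 + t) * (4 + t) + 25) + K                               ≡⟨ rearrange t w ⟩
  4 * (1 + t) * (2 + t) + 2 * (3 + t) * (w + (3 + t)) + 22 * (4 + t) ∎)
  where
  open ≤-Reasoning
  K = (3 + t) * (3 + t) + 2 * w * (3 + t)
  expand : ∀ t w → (w + (3 + t)) * (w + (3 + t)) + 22 * (4 + t) ≡ (w * w + 22 * (4 + t)) + ((3 + t) * (3 + t) + 2 * w * (3 + t))
  expand = solve-∀
  rearrange : ∀ t w → (5 * (4 + t) * (4 + t) + 25) + ((3 + t) * (3 + t) + 2 * w * (3 + t))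
    ≡ 4 * (1 + t) * (2 + t) + 2 * (3 + t) * (w + (3 + t)) + 22 * (4 + t)
  rearrange = solve-∀

D²-bound⇒binomial-condition : ∀ t e →
  2 * suc e * (2 * suc e) < 4 * (1 + t) * (2 + t) + 2 * (3 + t) * (2 * suc e) →
  e * suc e < (2 + t) * suc (suc t + e)
D²-bound⇒binomial-condition t e H =
  *-cancelˡ-< 4 (e * suc e) ((2 + t) * suc (suc t + e))
    (+-cancelʳ-< (2 * (2 * suc e)) _ _ (subst₂ _<_ (square e) (rescale t e) H))
  where
  square : ∀ e → 2 * suc e * (2 * suc e) ≡ 4 * (e * suc e) + 2 * (2 * suc e)
  square = solve-∀
  rescale : ∀ t e → 4 * (1 + t) * (2 + t) + 2 * (3 + t) * (2 * suc e) ≡ 4 * ((2 + t) * suc (suc t + e)) + 2 * (2 * suc e)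
  rescale = solve-∀

discriminant⇒binomial-condition : ∀ t e →
  (2 * (6 + t + e) ∸ (3 * (4 + t) + 1)) * (2 * (6 + t + e) ∸ (3 * (4 + t) + 1)) + 22 * (4 + t) < 5 * (4 + t) * (4 + t) + 25 →
  e * suc e < (2 + t) * suc (suc t + e)
discriminant⇒binomial-condition t e H with 3 + t ≤? 2 * suc e
... | yes 3+t≤D =
  D²-bound⇒binomial-condition t e
    (subst (λ D → D * D < 4 * (1 + t) * (2 + t) + 2 * (3 + t) * D) (m∸n+n≡m 3+t≤D)
      (discriminant⇒D²-bound t w (subst (λ x → x * x + 22 * (4 + t) < 5 * (4 + t) * (4 + t) + 25) D≡w H)))
  where
  w = 2 * suc e ∸ (3 + t)
  D≡w : 2 * (6 + t + e) ∸ (3 * (4 + t) + 1) ≡ w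
  D≡w = trans (cong₂ _∸_ (twice-n t e) (thrice-r t)) ([m+n]∸[m+o]≡n∸o (2 * t + 10) (2 * suc e) (3 + t))
    where
    twice-n : ∀ t e → 2 * (6 + t + e) ≡ (2 * t + 10) + 2 * suc e
    twice-n = solve-∀
    thrice-r : ∀ t → 3 * (4 + t) + 1 ≡ (2 * t + 10) + (3 + t)
    thrice-r = solve-∀
-- Here 2n < 3r + 1, so the truncated subtraction makes H vacuous; but then e + 1 ≤ t + 2.
... | no D≱3+t = begin-strict
  e * suc e             ≤⟨ *-monoʳ-≤ e e+1≤t+2 ⟩
  e * (2 + t)           ≡⟨ *-comm e (2 + t) ⟩
  (2 + t) * e           <⟨ *-monoʳ-< (2 + t) (s≤s (m≤n+m e (suc t))) ⟩
  (2 + t) * suc (suc t + e) ∎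
  where
  open ≤-Reasoning
  e+1≤t+2 : suc e ≤ 2 + t
  e+1≤t+2 = ≤-trans (m≤m+n (suc e) (suc e + 0)) (s≤s⁻¹ (≰⇒> D≱3+t))

m+n≡o+p⇒p<n⇒m<o : ∀ {m n o p} → m + n ≡ o + p → p < n → m < o
m+n≡o+p⇒p<n⇒m<o {m} {n} {o} eq p<n = +-cancelʳ-< n m o (subst (_< o + n) (sym eq) (+-monoʳ-< o p<n))

proposition6 : (r n : ℕ) → 4 ≤ r → r + 2 ≤ n →
    (2 * n ∸ (3 * r + 1)) * (2 * n ∸ (3 * r + 1)) + 22 * r < 5 * r * r + 25 →
    length (restrict (S n r) (2 ∷ 4 ∷ (r + 2) ∷ []))
      < length (restrict (F r n ((2 ∷ 3 ∷ []) ∷ [])) (2 ∷ 4 ∷ (r + 2) ∷ []))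
proposition6 (suc (suc (suc (suc t)))) (suc (suc (suc (suc n)))) (s≤s (s≤s (s≤s (s≤s z≤n)))) (s≤s (s≤s (s≤s (s≤s t+2≤n)))) H
  with e , refl ← m≤n⇒∃[o]m+o≡n (subst (_≤ n) (+-comm t 2) t+2≤n) =
  m+n≡o+p⇒p<n⇒m<o
    (length-S[X]+C≡length-F[X]+C t (suc t + e) (s≤s (m≤m+n t e)))
    ([t+e+1]C[t+2]<[t+e+2]C[t+1] t e (discriminant⇒binomial-condition t e H))
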